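{- Let $G=(V,E)$ be a strongly connected digraph that has a good decomposition $C_1,\dots,C_N$ with witness set $F$. Then for every integer $t\ge0$ and every $Q\subseteq F$, we have $y^{Q,t}\in SA^t(P)$, where $P$ is the cone of the balanced polytope of $G$.
   Context: Good decomposition: a strongly connected digraph $G=(V,E)$ has a good decomposition with witness set $F$ if $E$ is partitioned into edge-disjoint dicycles $C_1,\dots,C_N$ (so $E=\bigcup_j E(C_j)$), and $F$ is a nonempty subset of $\{1,\dots,N\}$ such that $G-E(C_j)$ is strongly connected for every $j\in F$. Balanced polytope of $G$: the set of $x\in\mathbb{R}^E$ with $x(\delta^{in}(S))\ge1$, $x(\delta^{out}(S))\ge1$ for all $\emptyset\subsetneq S\subsetneq V$, $x(\delta^{out}(\{v\}))=x(\delta^{in}(\{v\}))$ for all $v\in V$, $0\le x\le1$ ($\delta^{in},\delta^{out}$ = entering/leaving edges of $G$, $x(A)=\sum_{e\in A}x_e$). Its cone is $\{\lambda(1,x):\lambda\ge0,\ x\text{ in the polytope}\}$, i.e. the set of $(x_0,x)$ satisfying the homogenized constraints $\sum a_ix_i\ge bx_0$. Sherali–Adams for a cone: if $\hat P\subseteq[0,1]^n$ is described by inequalities $\sum_i a_iy_i\ge b$ (including $0\le y_i\le1$, equations as two inequalities) and $P$ is its cone, $SA^t(P)$ is the set of vectors $y=(y_S)$ indexed by subsets $S\subseteq\{1,\dots,n\}$ with $|S|\le t+1$ (including $S=\emptyset$) such that for every inequality and every pair of disjoint $S,Q'$ with $|S|+|Q'|\le t$: $\sum_i a_i\sum_{T\subseteq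 Q'}(-1)^{|T|}y_{S\cup T\cup\{i\}}\ge b\sum_{T\subseteq Q'}(-1)^{|T|}y_{S\cup T}$. The vector $y^{Q,t}$: indexed by all $S\subseteq E$ with $|S|\le t+1$, $y^{Q,t}_S=\frac{t+2-g_Q(S)}{t+2}$, where $g_Q(S)$ is the number of indices $j\in F-Q$ with $E(C_j)\cap S\neq\emptyset$. (In particular $y^{Q,t}_\emptyset=1$.) -}

module Defs where

open import Data.Nat as ℕ using (ℕ; zero; suc; _+_)
open import Data.Nat.DivMod using (_%_; m%n<n)
open import Data.Bool using (Bool; true; false; _∧_; not; if_then_else_)
open import Data.Fin using (Fin; fromℕ<; toℕ)
open import Data.Fin.Properties using (any?)
open import Data.Fin.Subset using (Subset; _∈_; _∉_; _⊆_; ∣_∣; ⁅_⁆; ∁; _∪_; _∩_; Nonempty)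
open import Data.Fin.Subset.Properties using (nonempty?)
open import Data.Vec using (Vec; []; _∷_; lookup; tabulate)
open import Data.Integer as ℤ using (+_)
open import Data.Rational as ℚ using (ℚ; 0ℚ; 1ℚ; _/_; _≥_)
open import Data.Product using (Σ; ∃; _×_; _,_)
open import Function.Definitions using (Injective)
open import Relation.Binary.PropositionalEquality using (_≡_)
open import Relation.Nullary.Decidable using (⌊_⌋)

record Digraph : Set where
  field
    n   : ℕ
    m   : ℕ
    src : Fin m → Fin n
    tgt : Fin m → Fin n
open Digraph public

module _ (G : Digraph) where

  data Reach (A : Subset (m G)) : Fin (n G) → Fin (n G) → Set where
    here : ∀ {u} → Reach A u u
    step : ∀ {v} (e : Fin (m G)) → e ∈ A → Reach A (tgt G e) v → Reach A (src G e) v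

  StronglyConnectedOn : Subset (m G) → Set
  StronglyConnectedOn A = ∀ u v → Reach A u v

  StronglyConnected : Set
  StronglyConnected = StronglyConnectedOn (tabulate (λ _ → true))

next : ∀ {k} → Fin (suc k) → Fin (suc k)
next {k} i = fromℕ< (m%n<n (suc (toℕ i)) (suc k))

record Dicycle (G : Digraph) : Set where
  field
    len    : ℕ                       -- the cycle has suc len edges
    edge   : Fin (suc len) → Fin (m G)
    closed : ∀ i → tgt G (edge i) ≡ src G (edge (next i))
    simple : Injective _≡_ _≡_ (λ i → src G (edge i))
open Dicycle public

edgeSet : ∀ {G} → Dicycle G → Subset (m G)
edgeSet C = tabulate (λ e → ⌊ any? (λ i → edge C i Data.Fin.≟ e) ⌋)

record GoodDecomposition (G : Digraph) (N : ℕ) (C : Fin N → Dicycle G) (F : Subset N) : Set where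
  field
    cover    : ∀ e → ∃ λ j → e ∈ edgeSet (C j)
    disjoint : ∀ e j j' → e ∈ edgeSet (C j) → e ∈ edgeSet (C j') → j ≡ j'
    F-nonempty : Nonempty F
    F-good   : ∀ j → j ∈ F → StronglyConnectedOn G (∁ (edgeSet (C j)))

Σℚ : ∀ {k} → (Fin k → ℚ) → ℚ
Σℚ {zero} f = 0ℚ
Σℚ {suc k} f = f Data.Fin.zero ℚ.+ Σℚ (λ i → f (Data.Fin.suc i))

-- altSum Q f = Σ_{T ⊆ Q} (-1)^|T| f T
altSum : ∀ {k} → Subset k → (Subset k → ℚ) → ℚ
altSum [] f = f []
altSum (false ∷ Q) f = altSum Q (λ T → f (false ∷ T))
altSum (true ∷ Q) f = altSum Q (λ T → f (false ∷ T)) ℚ.- altSum Q (λ T → f (true ∷ T))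

record IneqSystem (k : ℕ) : Set₁ where
  field
    Idx  : Set
    coef : Idx → Fin k → ℚ
    rhs  : Idx → ℚ
open IneqSystem public

Disjoint : ∀ {k} → Subset k → Subset k → Set
Disjoint S Q = ∀ i → i ∈ S → i ∉ Q

-- y ∈ SA^t(P), where P is the cone of the polytope described by the system;
-- y is given on all subsets, only values at |S| ≤ t+1 are ever inspected
InSA : ∀ {k} → IneqSystem k → ℕ → (Subset k → ℚ) → Set
InSA Sys t y =
  ∀ (c : Idx Sys) (S Q' : Subset _) → Disjoint S Q' → ∣ S ∣ + ∣ Q' ∣ ℕ.≤ t →
    Σℚ (λ i → coef Sys c i ℚ.* altSum Q' (λ T → y (S ∪ T ∪ ⁅ i ⁆)))
      ≥ rhs Sys c ℚ.* altSum Q' (λ T → y (S ∪ T))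

module _ (G : Digraph) where

  ind : Bool → ℚ
  ind b = if b then 1ℚ else 0ℚ

  inB : Subset (n G) → Fin (m G) → Bool
  inB S e = lookup S (tgt G e) ∧ not (lookup S (src G e))
  outB : Subset (n G) → Fin (m G) → Bool
  outB S e = lookup S (src G e) ∧ not (lookup S (tgt G e))

  data BalCon : Set where
    cutIn cutOut : (S : Subset (n G)) → Nonempty S → Nonempty (∁ S) → BalCon
    balOI balIO  : Fin (n G) → BalCon
    lower upper  : Fin (m G) → BalCon

  balCoef : BalCon → Fin (m G) → ℚ
  balCoef (cutIn S _ _) e = ind (inB S e)
  balCoef (cutOut S _ _) e = ind (outB S e)
  balCoef (balOI v) e = ind (outB ⁅ v ⁆ e) ℚ.- ind (inB ⁅ v ⁆ e)
  balCoef (balIO v) e = ind (inB ⁅ v ⁆ e) ℚ.- ind (outB ⁅ v ⁆ e)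
  balCoef (lower f) e = ind ⌊ f Data.Fin.≟ e ⌋
  balCoef (upper f) e = ℚ.- ind ⌊ f Data.Fin.≟ e ⌋

  balRhs : BalCon → ℚ
  balRhs (cutIn _ _ _) = 1ℚ
  balRhs (cutOut _ _ _) = 1ℚ
  balRhs (balOI _) = 0ℚ
  balRhs (balIO _) = 0ℚ
  balRhs (lower _) = 0ℚ
  balRhs (upper _) = ℚ.- 1ℚ

  BalancedSystem : IneqSystem (m G)
  BalancedSystem = record { Idx = BalCon ; coef = balCoef ; rhs = balRhs }

gQ : ∀ {G N} → (Fin N → Dicycle G) → (F Q : Subset N) → Subset (m G) → ℕ
gQ C F Q S = ∣ tabulate (λ j → lookup F j ∧ not (lookup Q j) ∧ ⌊ nonempty? (edgeSet (C j) ∩ S) ⌋) ∣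

yQt : ∀ {G N} → (Fin N → Dicycle G) → (F Q : Subset N) → ℕ → Subset (m G) → ℚ
yQt C F Q t S = (+ (suc (suc t)) ℤ.- + gQ C F Q S) / suc (suc t)

-- Let β = 1/(t+2) and call C_j counted when j ∈ F − Q.  Since g_Q(U) counts the counted
-- cycles meeting U, y(U) = α + β·#{counted j : E(C_j) ∩ U = ∅} is affine in disjointness
-- indicators.  By inclusion–exclusion, Σ_{T ⊆ Q'} (-1)^|T| [E(C_j) ∩ (A ∪ T) = ∅] is
-- [E(C_j) ∩ A = ∅ and Q' ⊆ E(C_j)], so both sides of a lifted inequality at (S, Q') are
-- "mixtures" X + β Σ_j q_j u_j(i) with X = [Q' = ∅]·α and u_j(i) = [i ∉ E(C_j)]
-- (module Mixture).  Such an inequality follows from the constant part and from each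
-- counted cycle separately (Constraints): flow conservation vanishes on cycles, the
-- bounds x_e ≥ 0, x_e ≤ 1 are immediate, and every cut stays crossed in G − E(C_j)
-- because that digraph is strongly connected.  When Q' = ∅ the lifted values are values
-- of y, bounded below by 1 − β|U| since g_Q(U) ≤ |U| (module Bounds).

module Submission where

open import Defs
open import Data.Nat using (ℕ)
import Data.Nat as ℕ
import Data.Nat.Properties as ℕP
open import Data.Fin using (Fin)
open import Data.Fin.Subset using (Subset; _⊆_)

open import Level using (0ℓ)
open import Data.Bool using (Bool; true; false; _∧_; _∨_; not; if_then_else_)
import Data.Bool.Properties as BoolP
open import Data.Empty using (⊥-elim)
open import Data.Fin using (zero; suc; _≟_; inject₁; fromℕ; toℕ)
import Data.Fin.Properties as FinP
open import Data.Nat.DivMod using (_%_; m<n⇒m%n≡m; n%n≡0)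
open import Data.Fin.Subset as Sub using (_∪_; _∩_; ⁅_⁆; ∁; ∣_∣; Nonempty)
import Data.Fin.Subset.Properties as SubP
open import Data.Vec using (_∷_; []; here; there; lookup; tabulate)
import Data.Vec.Properties as VecP
open import Data.Integer as ℤ using (ℤ; +_)
open import Data.Product using (∃; _×_; _,_; proj₁; proj₂)
open import Function using (_∘_)
open import Data.Rational as ℚ using (ℚ; 0ℚ; 1ℚ; _/_; _+_; _*_; _-_; -_; _≤_)
import Data.Rational.Properties as ℚP
open import Data.Rational.Properties using (≤-refl; ≤-trans; ≤-reflexive; +-mono-≤; +-monoʳ-≤; +-monoˡ-≤; neg-antimono-≤)
open import Data.Rational.Unnormalised as ℚᵘ using (mkℚᵘ; *≡*)
import Data.Rational.Unnormalised.Properties as ℚᵘP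
import Data.Integer.Properties as ℤP
open import Data.Sum using (_⊎_; inj₁; inj₂)
open import Relation.Nullary using (¬_; yes; no)
open import Relation.Nullary.Decidable using (⌊_⌋; dec⇒maybe)
open import Relation.Binary.PropositionalEquality
open import Tactic.RingSolver using (solve-∀)
open import Tactic.RingSolver.Core.AlmostCommutativeRing using (AlmostCommutativeRing; fromCommutativeRing)
import Data.Integer.Tactic.RingSolver as ℤ-Solver

ℚ-ring : AlmostCommutativeRing 0ℓ 0ℓ
ℚ-ring = fromCommutativeRing ℚP.+-*-commutativeRing (λ x → dec⇒maybe (0ℚ ℚP.≟ x))

𝟙 : Bool → ℚ
𝟙 b = if b then 1ℚ else 0ℚ

0≤𝟙 : ∀ b → 0ℚ ≤ 𝟙 b
0≤𝟙 true  = ℚP.nonNegative⁻¹ 1ℚ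
0≤𝟙 false = ≤-refl

𝟙≤1 : ∀ b → 𝟙 b ≤ 1ℚ
𝟙≤1 true  = ≤-refl
𝟙≤1 false = 0≤𝟙 true

𝟙-∧ : ∀ a b → 𝟙 (a ∧ b) ≡ 𝟙 a * 𝟙 b
𝟙-∧ true  b = sym (ℚP.*-identityˡ (𝟙 b))
𝟙-∧ false b = sym (ℚP.*-zeroˡ (𝟙 b))

𝟙-not : ∀ a → 𝟙 (not a) ≡ 1ℚ - 𝟙 a
𝟙-not true  = refl
𝟙-not false = refl

-- case analysis on a boolean expression that keeps the equation, without abstracting it
true-or-false : ∀ b → b ≡ true ⊎ b ≡ false
true-or-false true  = inj₁ refl
true-or-false false = inj₂ refl

-- the net flow of an edge out of a vertex set, as a difference of indicators
𝟙-difference : ∀ x y → 𝟙 (x ∧ not y) - 𝟙 (y ∧ not x) ≡ 𝟙 x - 𝟙 y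
𝟙-difference true  true  = refl
𝟙-difference true  false = refl
𝟙-difference false true  = refl
𝟙-difference false false = refl

intℚ : ℤ → ℚ
intℚ i = i / 1

natℚ : ℕ → ℚ
natℚ k = + k / 1

-- identities between fractions are checked on unnormalised representatives
module _ where
  open ℚᵘP.≃-Reasoning

  /-toℚᵘ : ∀ i d → ℚ.toℚᵘ (i / ℕ.suc d) ℚᵘ.≃ mkℚᵘ i d
  /-toℚᵘ i d = ℚP.toℚᵘ-fromℚᵘ (mkℚᵘ i d)

  intℚ-+ : ∀ i j → intℚ (i ℤ.+ j) ≡ intℚ i + intℚ j
  intℚ-+ i j = ℚP.toℚᵘ-injective (begin
    ℚ.toℚᵘ (intℚ (i ℤ.+ j))                ≈⟨ /-toℚᵘ (i ℤ.+ j) 0 ⟩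
    mkℚᵘ (i ℤ.+ j) 0                       ≈⟨ *≡* (denominator-one i j) ⟩
    mkℚᵘ i 0 ℚᵘ.+ mkℚᵘ j 0                 ≈⟨ ℚᵘP.+-cong (ℚᵘP.≃-sym (/-toℚᵘ i 0)) (ℚᵘP.≃-sym (/-toℚᵘ j 0)) ⟩
    ℚ.toℚᵘ (intℚ i) ℚᵘ.+ ℚ.toℚᵘ (intℚ j)   ≈⟨ ℚᵘP.≃-sym (ℚP.toℚᵘ-homo-+ (intℚ i) (intℚ j)) ⟩
    ℚ.toℚᵘ (intℚ i + intℚ j)               ∎)
    where
    denominator-one : ∀ i j → (i ℤ.+ j) ℤ.* + 1 ≡ (i ℤ.* + 1 ℤ.+ j ℤ.* + 1) ℤ.* + 1
    denominator-one = ℤ-Solver.solve-∀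

  intℚ-neg : ∀ i → intℚ (ℤ.- i) ≡ - intℚ i
  intℚ-neg i = ℚP.toℚᵘ-injective (begin
    ℚ.toℚᵘ (intℚ (ℤ.- i))   ≈⟨ /-toℚᵘ (ℤ.- i) 0 ⟩
    ℚᵘ.- mkℚᵘ i 0           ≈⟨ ℚᵘP.-‿cong (ℚᵘP.≃-sym (/-toℚᵘ i 0)) ⟩
    ℚᵘ.- ℚ.toℚᵘ (intℚ i)    ≈⟨ ℚᵘP.≃-sym (ℚP.toℚᵘ-homo‿- (intℚ i)) ⟩
    ℚ.toℚᵘ (- intℚ i)       ∎)

  /-as-* : ∀ i d → i / ℕ.suc d ≡ intℚ i * (+ 1 / ℕ.suc d)
  /-as-* i d = ℚP.toℚᵘ-injective (begin
    ℚ.toℚᵘ (i / ℕ.suc d)                          ≈⟨ /-toℚᵘ i d ⟩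
    mkℚᵘ i d                                      ≈⟨ *≡* (cross-multiply i d) ⟩
    mkℚᵘ i 0 ℚᵘ.* mkℚᵘ (+ 1) d                    ≈⟨ ℚᵘP.*-cong (ℚᵘP.≃-sym (/-toℚᵘ i 0)) (ℚᵘP.≃-sym (/-toℚᵘ (+ 1) d)) ⟩
    ℚ.toℚᵘ (intℚ i) ℚᵘ.* ℚ.toℚᵘ (+ 1 / ℕ.suc d)   ≈⟨ ℚᵘP.≃-sym (ℚP.toℚᵘ-homo-* (intℚ i) (+ 1 / ℕ.suc d)) ⟩
    ℚ.toℚᵘ (intℚ i * (+ 1 / ℕ.suc d))             ∎)
    where
    cross-multiply : ∀ i d → i ℤ.* + ℕ.suc (d ℕ.+ 0) ≡ i ℤ.* + 1 ℤ.* + ℕ.suc d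
    cross-multiply i d rewrite ℕP.+-identityʳ d = unit-middle i (+ ℕ.suc d)
      where
      unit-middle : ∀ x y → x ℤ.* y ≡ x ℤ.* + 1 ℤ.* y
      unit-middle = ℤ-Solver.solve-∀

  n/n≡1 : ∀ d → + ℕ.suc d / ℕ.suc d ≡ 1ℚ
  n/n≡1 d = ℚP.toℚᵘ-injective (begin
    ℚ.toℚᵘ (+ ℕ.suc d / ℕ.suc d)   ≈⟨ /-toℚᵘ (+ ℕ.suc d) d ⟩
    mkℚᵘ (+ ℕ.suc d) d             ≈⟨ *≡* (ℤP.*-comm (+ ℕ.suc d) (+ 1)) ⟩
    mkℚᵘ (+ 1) 0                   ≈⟨ ℚᵘP.≃-sym (/-toℚᵘ (+ 1) 0) ⟩
    ℚ.toℚᵘ 1ℚ                      ∎)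

natℚ-+ : ∀ a b → natℚ (a ℕ.+ b) ≡ natℚ a + natℚ b
natℚ-+ a b = trans (cong intℚ (ℤP.pos-+ a b)) (intℚ-+ (+ a) (+ b))

0≤k/n : ∀ k d → 0ℚ ≤ + k / ℕ.suc d
0≤k/n k d = ℚP.nonNegative⁻¹ _ {{ℚP.normalize-nonNeg k (ℕ.suc d)}}

natℚ-mono : ∀ {a b} → a ℕ.≤ b → natℚ a ≤ natℚ b
natℚ-mono {a} {b} a≤b = begin
  natℚ a                      ≡⟨ ℚP.+-identityʳ (natℚ a) ⟨
  natℚ a + 0ℚ                 ≤⟨ +-monoʳ-≤ (natℚ a) (0≤k/n (b ℕ.∸ a) 0) ⟩
  natℚ a + natℚ (b ℕ.∸ a)     ≡⟨ natℚ-+ a (b ℕ.∸ a) ⟨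
  natℚ (a ℕ.+ (b ℕ.∸ a))      ≡⟨ cong natℚ (ℕP.m+[n∸m]≡n a≤b) ⟩
  natℚ b                      ∎
  where open ℚP.≤-Reasoning

1/n*n≡1 : ∀ d → (+ 1 / ℕ.suc d) * natℚ (ℕ.suc d) ≡ 1ℚ
1/n*n≡1 d = begin
  (+ 1 / ℕ.suc d) * natℚ (ℕ.suc d)   ≡⟨ ℚP.*-comm (+ 1 / ℕ.suc d) (natℚ (ℕ.suc d)) ⟩
  natℚ (ℕ.suc d) * (+ 1 / ℕ.suc d)   ≡⟨ /-as-* (+ ℕ.suc d) d ⟨
  + ℕ.suc d / ℕ.suc d                ≡⟨ n/n≡1 d ⟩
  1ℚ                                 ∎
  where open ≡-Reasoning

-- (D - g)/D = 1 - (1/D)·g, the form in which the vector y^{Q,t} is used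
complement-fraction : ∀ d g → (+ ℕ.suc d ℤ.- + g) / ℕ.suc d ≡ 1ℚ - (+ 1 / ℕ.suc d) * natℚ g
complement-fraction d g = begin
  (+ D ℤ.- + g) / D                  ≡⟨ /-as-* (+ D ℤ.- + g) d ⟩
  intℚ (+ D ℤ.- + g) * β             ≡⟨ cong (_* β) (trans (intℚ-+ (+ D) (ℤ.- + g)) (cong (λ x → natℚ D + x) (intℚ-neg (+ g)))) ⟩
  (natℚ D - natℚ g) * β              ≡⟨ distribute (natℚ D) (natℚ g) β ⟩
  β * natℚ D - β * natℚ g            ≡⟨ cong (_- β * natℚ g) (1/n*n≡1 d) ⟩
  1ℚ - β * natℚ g                    ∎
  where
  open ≡-Reasoning
  D = ℕ.suc d
  β = + 1 / D
  distribute : ∀ x y b → (x - y) * b ≡ b * x - b * y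
  distribute = solve-∀ ℚ-ring

*-monoˡ-≤-0≤ : ∀ {r p q} → 0ℚ ≤ r → p ≤ q → r * p ≤ r * q
*-monoˡ-≤-0≤ {r} 0≤r = ℚP.*-monoˡ-≤-nonNeg r {{ℚ.nonNegative 0≤r}}

*-monoʳ-≤-0≤ : ∀ {r p q} → 0ℚ ≤ r → p ≤ q → p * r ≤ q * r
*-monoʳ-≤-0≤ {r} 0≤r = ℚP.*-monoʳ-≤-nonNeg r {{ℚ.nonNegative 0≤r}}

0≤-* : ∀ {a b} → 0ℚ ≤ a → 0ℚ ≤ b → 0ℚ ≤ a * b
0≤-* {a} 0≤a 0≤b = ≤-trans (≤-reflexive (sym (ℚP.*-zeroʳ a))) (*-monoˡ-≤-0≤ 0≤a 0≤b)

0≤-sub⇒≤ : ∀ {p q} → 0ℚ ≤ q - p → p ≤ q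
0≤-sub⇒≤ {p} {q} 0≤q-p = begin
  p                ≡⟨ ℚP.+-identityʳ p ⟨
  p + 0ℚ           ≤⟨ +-monoʳ-≤ p 0≤q-p ⟩
  p + (q - p)      ≡⟨ cancel p q ⟩
  q                ∎
  where
  open ℚP.≤-Reasoning
  cancel : ∀ p q → p + (q - p) ≡ q
  cancel = solve-∀ ℚ-ring

≤⇒0≤-sub : ∀ {p q} → p ≤ q → 0ℚ ≤ q - p
≤⇒0≤-sub {p} p≤q = ≤-trans (≤-reflexive (sym (ℚP.+-inverseʳ p))) (+-monoˡ-≤ (- p) p≤q)

*-≤-[0,1] : ∀ {r x} → 0ℚ ≤ r → r ≤ 1ℚ → 0ℚ ≤ x → r * x ≤ x
*-≤-[0,1] {r} {x} 0≤r r≤1 0≤x = ≤-trans (*-monoʳ-≤-0≤ 0≤x r≤1) (≤-reflexive (ℚP.*-identityˡ x))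

-- The arithmetic core of the cut constraints: if z ≥ 2β ≥ 0, d ≥ 1 and K ≤ d,
-- where K vanishes unless d ≥ 2, then z ≤ d·z − β·K.
cut-arithmetic : ∀ {β d z K} → 0ℚ ≤ β → 1ℚ ≤ d → β + β ≤ z → K ≤ d → (¬ (1ℚ + 1ℚ ≤ d) → K ≡ 0ℚ) →
                 z ≤ d * z - β * K
cut-arithmetic {β} {d} {z} {K} 0≤β 1≤d 2β≤z K≤d small-d⇒K≡0 with (1ℚ + 1ℚ) ℚP.≤? d
... | yes 2≤d = 0≤-sub⇒≤ (begin
  0ℚ                             ≤⟨ 0≤-* 0≤β (≤⇒0≤-sub 2≤d) ⟩
  β * (d - (1ℚ + 1ℚ))            ≡⟨ regroup β d ⟩
  (β + β) * (d - 1ℚ) - β * d     ≤⟨ +-mono-≤ (*-monoʳ-≤-0≤ (≤⇒0≤-sub 1≤d) 2β≤z) (neg-antimono-≤ (*-monoˡ-≤-0≤ 0≤β K≤d)) ⟩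
  z * (d - 1ℚ) - β * K           ≡⟨ rearrange z d β K ⟩
  (d * z - β * K) - z            ∎)
  where
  open ℚP.≤-Reasoning
  regroup : ∀ b d → b * (d - (1ℚ + 1ℚ)) ≡ (b + b) * (d - 1ℚ) - b * d
  regroup = solve-∀ ℚ-ring
  rearrange : ∀ z d b K → z * (d - 1ℚ) - b * K ≡ (d * z - b * K) - z
  rearrange = solve-∀ ℚ-ring
... | no ¬2≤d rewrite small-d⇒K≡0 ¬2≤d = 0≤-sub⇒≤ (begin
  0ℚ                             ≤⟨ 0≤-* (≤-trans (+-mono-≤ 0≤β 0≤β) 2β≤z) (≤⇒0≤-sub 1≤d) ⟩
  z * (d - 1ℚ)                   ≡⟨ rearrange z d β ⟩
  (d * z - β * 0ℚ) - z           ∎)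
  where
  open ℚP.≤-Reasoning
  rearrange : ∀ z d b → z * (d - 1ℚ) ≡ (d * z - b * 0ℚ) - z
  rearrange = solve-∀ ℚ-ring

Σ-cong : ∀ {k} {f g : Fin k → ℚ} → (∀ i → f i ≡ g i) → Σℚ f ≡ Σℚ g
Σ-cong {ℕ.zero}  f≗g = refl
Σ-cong {ℕ.suc k} f≗g = cong₂ _+_ (f≗g zero) (Σ-cong (λ i → f≗g (suc i)))

Σ-zero : ∀ {k} → Σℚ {k} (λ _ → 0ℚ) ≡ 0ℚ
Σ-zero {ℕ.zero}  = refl
Σ-zero {ℕ.suc k} = trans (ℚP.+-identityˡ _) (Σ-zero {k})

Σ-distrib-+ : ∀ {k} (f g : Fin k → ℚ) → Σℚ (λ i → f i + g i) ≡ Σℚ f + Σℚ g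
Σ-distrib-+ {ℕ.zero}  f g = refl
Σ-distrib-+ {ℕ.suc k} f g = begin
  (f zero + g zero) + Σℚ (λ i → f (suc i) + g (suc i))        ≡⟨ cong (_+_ (f zero + g zero)) (Σ-distrib-+ (f ∘ suc) (g ∘ suc)) ⟩
  (f zero + g zero) + (Σℚ (f ∘ suc) + Σℚ (g ∘ suc))          ≡⟨ interchange (f zero) (g zero) (Σℚ (f ∘ suc)) (Σℚ (g ∘ suc)) ⟩
  (f zero + Σℚ (f ∘ suc)) + (g zero + Σℚ (g ∘ suc))          ∎
  where
  open ≡-Reasoning
  interchange : ∀ a b c d → (a + b) + (c + d) ≡ (a + c) + (b + d)
  interchange = solve-∀ ℚ-ring

Σ-neg : ∀ {k} (f : Fin k → ℚ) → Σℚ (λ i → - f i) ≡ - Σℚ f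
Σ-neg {ℕ.zero}  f = refl
Σ-neg {ℕ.suc k} f = trans (cong (_+_ (- f zero)) (Σ-neg (f ∘ suc))) (sym (ℚP.neg-distrib-+ (f zero) (Σℚ (f ∘ suc))))

Σ-distrib-- : ∀ {k} (f g : Fin k → ℚ) → Σℚ (λ i → f i - g i) ≡ Σℚ f - Σℚ g
Σ-distrib-- f g = trans (Σ-distrib-+ f (λ i → - g i)) (cong (_+_ (Σℚ f)) (Σ-neg g))

Σ-*ˡ : ∀ {k} (c : ℚ) (f : Fin k → ℚ) → Σℚ (λ i → c * f i) ≡ c * Σℚ f
Σ-*ˡ {ℕ.zero}  c f = sym (ℚP.*-zeroʳ c)
Σ-*ˡ {ℕ.suc k} c f = trans (cong (_+_ (c * f zero)) (Σ-*ˡ c (f ∘ suc))) (sym (ℚP.*-distribˡ-+ c (f zero) (Σℚ (f ∘ suc))))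

Σ-*ʳ : ∀ {k} (c : ℚ) (f : Fin k → ℚ) → Σℚ (λ i → f i * c) ≡ Σℚ f * c
Σ-*ʳ c f = trans (Σ-cong (λ i → ℚP.*-comm (f i) c)) (trans (Σ-*ˡ c f) (ℚP.*-comm c (Σℚ f)))

Σ-comm : ∀ {a b} (f : Fin a → Fin b → ℚ) → Σℚ (λ i → Σℚ (λ j → f i j)) ≡ Σℚ (λ j → Σℚ (λ i → f i j))
Σ-comm {ℕ.zero}  {b} f = sym (Σ-zero {b})
Σ-comm {ℕ.suc a} f = trans (cong (_+_ (Σℚ (f zero))) (Σ-comm (f ∘ suc))) (sym (Σ-distrib-+ (f zero) (λ j → Σℚ (λ i → f (suc i) j))))

Σ-mono-≤ : ∀ {k} {f g : Fin k → ℚ} → (∀ i → f i ≤ g i) → Σℚ f ≤ Σℚ g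
Σ-mono-≤ {ℕ.zero}  f≤g = ≤-refl
Σ-mono-≤ {ℕ.suc k} f≤g = +-mono-≤ (f≤g zero) (Σ-mono-≤ (λ i → f≤g (suc i)))

Σ-nonNeg : ∀ {k} {f : Fin k → ℚ} → (∀ i → 0ℚ ≤ f i) → 0ℚ ≤ Σℚ f
Σ-nonNeg {k} 0≤f = ≤-trans (≤-reflexive (sym (Σ-zero {k}))) (Σ-mono-≤ 0≤f)

term≤Σ : ∀ {k} {f : Fin k → ℚ} → (∀ i → 0ℚ ≤ f i) → ∀ i → f i ≤ Σℚ f
term≤Σ {ℕ.suc k} {f} 0≤f zero    = ≤-trans (≤-reflexive (sym (ℚP.+-identityʳ (f zero)))) (+-monoʳ-≤ (f zero) (Σ-nonNeg (0≤f ∘ suc)))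
term≤Σ {ℕ.suc k} {f} 0≤f (suc i) = ≤-trans (≤-reflexive (sym (ℚP.+-identityˡ (f (suc i))))) (+-mono-≤ (0≤f zero) (term≤Σ (0≤f ∘ suc) i))

Σ-delta : ∀ {k} (i₀ : Fin k) (f : Fin k → ℚ) → Σℚ (λ i → 𝟙 ⌊ i₀ ≟ i ⌋ * f i) ≡ f i₀
Σ-delta {ℕ.suc k} zero f = begin
  1ℚ * f zero + Σℚ (λ i → 0ℚ * f (suc i))   ≡⟨ cong₂ _+_ (ℚP.*-identityˡ (f zero)) (trans (Σ-cong (λ i → ℚP.*-zeroˡ (f (suc i)))) (Σ-zero {k})) ⟩
  f zero + 0ℚ                               ≡⟨ ℚP.+-identityʳ (f zero) ⟩
  f zero                                    ∎
  where open ≡-Reasoning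
Σ-delta {ℕ.suc k} (suc i₀) f = begin
  0ℚ * f zero + Σℚ (λ i → 𝟙 ⌊ suc i₀ ≟ suc i ⌋ * f (suc i))   ≡⟨ cong₂ _+_ (ℚP.*-zeroˡ (f zero)) (Σ-cong (λ i → cong (λ b → 𝟙 b * f (suc i)) (≟-suc i))) ⟩
  0ℚ + Σℚ (λ i → 𝟙 ⌊ i₀ ≟ i ⌋ * f (suc i))                     ≡⟨ ℚP.+-identityˡ _ ⟩
  Σℚ (λ i → 𝟙 ⌊ i₀ ≟ i ⌋ * f (suc i))                          ≡⟨ Σ-delta i₀ (f ∘ suc) ⟩
  f (suc i₀)                                                   ∎
  where
  open ≡-Reasoning
  ≟-suc : ∀ i → ⌊ suc i₀ ≟ suc i ⌋ ≡ ⌊ i₀ ≟ i ⌋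
  ≟-suc i with i₀ ≟ i
  ... | yes _ = refl
  ... | no _  = refl

Σ𝟙-0-or-≥1 : ∀ {k} (b : Fin k → Bool) → (Σℚ (λ i → 𝟙 (b i)) ≡ 0ℚ) ⊎ (1ℚ ≤ Σℚ (λ i → 𝟙 (b i)))
Σ𝟙-0-or-≥1 {ℕ.zero} b = inj₁ refl
Σ𝟙-0-or-≥1 {ℕ.suc k} b with b zero | Σ𝟙-0-or-≥1 (b ∘ suc)
... | true  | _       = inj₂ (≤-trans (≤-reflexive (sym (ℚP.+-identityʳ 1ℚ))) (+-monoʳ-≤ 1ℚ (Σ-nonNeg (λ i → 0≤𝟙 (b (suc i))))))
... | false | inj₁ =0 = inj₁ (trans (ℚP.+-identityˡ _) =0)
... | false | inj₂ ≥1 = inj₂ (≤-trans ≥1 (≤-reflexive (sym (ℚP.+-identityˡ _))))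

isEmpty : ∀ {k} → Subset k → Bool
isEmpty []      = true
isEmpty (x ∷ p) = not x ∧ isEmpty p

isEmpty⇒≡⊥ : ∀ {k} (p : Subset k) → isEmpty p ≡ true → p ≡ Sub.⊥
isEmpty⇒≡⊥ []          _     = refl
isEmpty⇒≡⊥ (false ∷ p) empty = cong (false ∷_) (isEmpty⇒≡⊥ p empty)

¬isEmpty⇒nonempty : ∀ {k} (p : Subset k) → isEmpty p ≡ false → Nonempty p
¬isEmpty⇒nonempty (true ∷ p)  _ = zero , here
¬isEmpty⇒nonempty (false ∷ p) nonempty with ¬isEmpty⇒nonempty p nonempty
... | x , x∈p = suc x , there x∈p

nonempty?≡not-isEmpty : ∀ {k} (p : Subset k) → ⌊ SubP.nonempty? p ⌋ ≡ not (isEmpty p)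
nonempty?≡not-isEmpty p with SubP.nonempty? p | isEmpty p in eq
... | yes (x , x∈p) | true  = ⊥-elim (SubP.∉⊥ (subst (x Sub.∈_) (isEmpty⇒≡⊥ p eq) x∈p))
... | yes _         | false = refl
... | no _          | true  = refl
... | no ¬nonempty  | false = ⊥-elim (¬nonempty (¬isEmpty⇒nonempty p eq))

∣∣-as-Σ : ∀ {k} (U : Subset k) → natℚ ∣ U ∣ ≡ Σℚ (λ e → 𝟙 (lookup U e))
∣∣-as-Σ []          = refl
∣∣-as-Σ (true ∷ U)  = trans (natℚ-+ 1 ∣ U ∣) (cong (_+_ 1ℚ) (∣∣-as-Σ U))
∣∣-as-Σ (false ∷ U) = trans (∣∣-as-Σ U) (sym (ℚP.+-identityˡ _))

1-𝟙isEmpty≤Σ : ∀ {k} (p : Subset k) → 1ℚ - 𝟙 (isEmpty p) ≤ Σℚ (λ e → 𝟙 (lookup p e))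
1-𝟙isEmpty≤Σ []          = ≤-refl
1-𝟙isEmpty≤Σ (true ∷ p)  = ≤-trans (≤-reflexive (sym (ℚP.+-identityʳ 1ℚ))) (+-monoʳ-≤ 1ℚ (Σ-nonNeg (λ e → 0≤𝟙 (lookup p e))))
1-𝟙isEmpty≤Σ (false ∷ p) = ≤-trans (1-𝟙isEmpty≤Σ p) (≤-reflexive (sym (ℚP.+-identityˡ _)))

∣∪⁅⁆∣≤ : ∀ {k} (U : Subset k) (i : Fin k) → ∣ U ∪ ⁅ i ⁆ ∣ ℕ.≤ ℕ.suc ∣ U ∣
∣∪⁅⁆∣≤ (u ∷ U) zero rewrite SubP.∪-identityʳ U with u
... | true  = ℕP.n≤1+n _
... | false = ℕP.≤-refl
∣∪⁅⁆∣≤ (u ∷ U) (suc i) rewrite BoolP.∨-identityʳ u with u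
... | true  = ℕ.s≤s (∣∪⁅⁆∣≤ U i)
... | false = ∣∪⁅⁆∣≤ U i

altSum-cong : ∀ {k} (Q : Subset k) {f g : Subset k → ℚ} → (∀ T → f T ≡ g T) → altSum Q f ≡ altSum Q g
altSum-cong []          f≗g = f≗g []
altSum-cong (false ∷ Q) f≗g = altSum-cong Q (λ T → f≗g (false ∷ T))
altSum-cong (true ∷ Q)  f≗g = cong₂ _-_ (altSum-cong Q (λ T → f≗g (false ∷ T))) (altSum-cong Q (λ T → f≗g (true ∷ T)))

altSum-const : ∀ {k} (Q : Subset k) c → altSum Q (λ _ → c) ≡ 𝟙 (isEmpty Q) * c
altSum-const []          c = sym (ℚP.*-identityˡ c)
altSum-const (false ∷ Q) c = altSum-const Q c
altSum-const (true ∷ Q)  c = trans (ℚP.+-inverseʳ (altSum Q (λ _ → c))) (sym (ℚP.*-zeroˡ c))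

altSum-zero : ∀ {k} (Q : Subset k) → altSum Q (λ _ → 0ℚ) ≡ 0ℚ
altSum-zero Q = trans (altSum-const Q 0ℚ) (ℚP.*-zeroʳ (𝟙 (isEmpty Q)))

altSum-⊥ : ∀ {k} (f : Subset k → ℚ) → altSum Sub.⊥ f ≡ f Sub.⊥
altSum-⊥ {ℕ.zero}  f = refl
altSum-⊥ {ℕ.suc k} f = altSum-⊥ (λ T → f (false ∷ T))

altSum-empty : ∀ {k} (Q : Subset k) → isEmpty Q ≡ true → ∀ f → altSum Q f ≡ f Sub.⊥
altSum-empty Q empty f = trans (cong (λ P → altSum P f) (isEmpty⇒≡⊥ Q empty)) (altSum-⊥ f)

altSum-+ : ∀ {k} (Q : Subset k) (f g : Subset k → ℚ) → altSum Q (λ T → f T + g T) ≡ altSum Q f + altSum Q g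
altSum-+ []          f g = refl
altSum-+ (false ∷ Q) f g = altSum-+ Q (λ T → f (false ∷ T)) (λ T → g (false ∷ T))
altSum-+ (true ∷ Q)  f g = begin
  altSum Q (λ T → f (false ∷ T) + g (false ∷ T)) - altSum Q (λ T → f (true ∷ T) + g (true ∷ T))
    ≡⟨ cong₂ _-_ (altSum-+ Q (λ T → f (false ∷ T)) (λ T → g (false ∷ T))) (altSum-+ Q (λ T → f (true ∷ T)) (λ T → g (true ∷ T))) ⟩
  (f₀ + g₀) - (f₁ + g₁)  ≡⟨ interchange f₀ g₀ f₁ g₁ ⟩
  (f₀ - f₁) + (g₀ - g₁)  ∎
  where
  open ≡-Reasoning
  f₀ = altSum Q (λ T → f (false ∷ T))
  f₁ = altSum Q (λ T → f (true ∷ T))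
  g₀ = altSum Q (λ T → g (false ∷ T))
  g₁ = altSum Q (λ T → g (true ∷ T))
  interchange : ∀ a b c d → (a + b) - (c + d) ≡ (a - c) + (b - d)
  interchange = solve-∀ ℚ-ring

altSum-*ˡ : ∀ {k} (Q : Subset k) (c : ℚ) (f : Subset k → ℚ) → altSum Q (λ T → c * f T) ≡ c * altSum Q f
altSum-*ˡ []          c f = refl
altSum-*ˡ (false ∷ Q) c f = altSum-*ˡ Q c (λ T → f (false ∷ T))
altSum-*ˡ (true ∷ Q)  c f =
  trans (cong₂ _-_ (altSum-*ˡ Q c (λ T → f (false ∷ T))) (altSum-*ˡ Q c (λ T → f (true ∷ T))))
        (factor c (altSum Q (λ T → f (false ∷ T))) (altSum Q (λ T → f (true ∷ T))))
  where
  factor : ∀ c a b → c * a - c * b ≡ c * (a - b)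
  factor = solve-∀ ℚ-ring

altSum-Σ : ∀ {k N} (Q : Subset k) (f : Fin N → Subset k → ℚ) →
           altSum Q (λ T → Σℚ (λ j → f j T)) ≡ Σℚ (λ j → altSum Q (f j))
altSum-Σ {N = ℕ.zero}  Q f = altSum-zero Q
altSum-Σ {N = ℕ.suc N} Q f = trans (altSum-+ Q (f zero) (λ T → Σℚ (λ j → f (suc j) T)))
                                   (cong (_+_ (altSum Q (f zero))) (altSum-Σ Q (f ∘ suc)))

missesAndContains : ∀ {k} → Subset k → Subset k → Subset k → Bool
missesAndContains []      []      []      = true
missesAndContains (c ∷ C) (a ∷ A) (q ∷ Q) = not (c ∧ a) ∧ (not q ∨ c) ∧ missesAndContains C A Q

-- Σ_{T ⊆ Q} (-1)^|T| [C ∩ (A ∪ T) = ∅] = [C ∩ A = ∅ and Q ⊆ C]: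
-- an element of Q outside C makes the terms cancel in pairs.
altSum-disjoint : ∀ {k} (C A Q : Subset k) →
                  altSum Q (λ T → 𝟙 (isEmpty (C ∩ (A ∪ T)))) ≡ 𝟙 (missesAndContains C A Q)
altSum-disjoint []          []          []          = refl
altSum-disjoint (true ∷ C)  (true ∷ A)  (false ∷ Q) = altSum-zero Q
altSum-disjoint (true ∷ C)  (false ∷ A) (false ∷ Q) = altSum-disjoint C A Q
altSum-disjoint (false ∷ C) (a ∷ A)     (false ∷ Q) = altSum-disjoint C A Q
altSum-disjoint (true ∷ C)  (true ∷ A)  (true ∷ Q)  = cong₂ _-_ (altSum-zero Q) (altSum-zero Q)
altSum-disjoint (true ∷ C)  (false ∷ A) (true ∷ Q)  =
  trans (cong₂ _-_ (altSum-disjoint C A Q) (altSum-zero Q)) (ℚP.+-identityʳ _)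
altSum-disjoint (false ∷ C) (a ∷ A)     (true ∷ Q)  = ℚP.+-inverseʳ (altSum Q (λ T → 𝟙 (isEmpty (C ∩ (A ∪ T)))))

missesAndContains-∪⁅⁆ : ∀ {k} (C A Q : Subset k) (i : Fin k) →
                        missesAndContains C (A ∪ ⁅ i ⁆) Q ≡ missesAndContains C A Q ∧ not (lookup C i)
missesAndContains-∪⁅⁆ (c ∷ C) (a ∷ A) (q ∷ Q) zero rewrite SubP.∪-identityʳ A with c | a
... | false | _     = sym (BoolP.∧-identityʳ _)
... | true  | true  = refl
... | true  | false = sym (BoolP.∧-zeroʳ _)
missesAndContains-∪⁅⁆ (c ∷ C) (a ∷ A) (q ∷ Q) (suc i) rewrite BoolP.∨-identityʳ a
                                                           | missesAndContains-∪⁅⁆ C A Q i =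
  trans (cong (_∧_ (not (c ∧ a))) (sym (BoolP.∧-assoc (not q ∨ c) _ _))) (sym (BoolP.∧-assoc (not (c ∧ a)) _ _))

-- A linear inequality  b·mix₀ ≤ Σ_i a_i mix i  then follows from the same
-- inequality for the constant part and, weight by weight, for each u_j.

module Mixture {n N : ℕ} (X β : ℚ) (q : Fin N → ℚ) (u : Fin N → Fin n → ℚ) where

  mix : Fin n → ℚ
  mix i = X + β * Σℚ (λ j → q j * u j i)

  mix₀ : ℚ
  mix₀ = X + β * Σℚ q

  pairing : (Fin n → ℚ) → Fin N → ℚ
  pairing a j = Σℚ (λ i → a i * u j i)

  mix-expand : ∀ (a : Fin n → ℚ) → Σℚ (λ i → a i * mix i) ≡ Σℚ a * X + β * Σℚ (λ j → q j * pairing a j)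
  mix-expand a = begin
    Σℚ (λ i → a i * mix i)
      ≡⟨ Σ-cong (λ i → trans (distribute (a i) X β _) (cong (λ s → a i * X + β * s) (sym (Σ-*ˡ (a i) (λ j → q j * u j i))))) ⟩
    Σℚ (λ i → a i * X + β * Σℚ (λ j → a i * (q j * u j i)))
      ≡⟨ Σ-distrib-+ (λ i → a i * X) (λ i → β * Σℚ (λ j → a i * (q j * u j i))) ⟩
    Σℚ (λ i → a i * X) + Σℚ (λ i → β * Σℚ (λ j → a i * (q j * u j i)))
      ≡⟨ cong₂ _+_ (Σ-*ʳ X a) (Σ-*ˡ β (λ i → Σℚ (λ j → a i * (q j * u j i)))) ⟩
    Σℚ a * X + β * Σℚ (λ i → Σℚ (λ j → a i * (q j * u j i)))
      ≡⟨ cong (λ s → Σℚ a * X + β * s) (Σ-comm (λ i j → a i * (q j * u j i))) ⟩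
    Σℚ a * X + β * Σℚ (λ j → Σℚ (λ i → a i * (q j * u j i)))
      ≡⟨ cong (λ s → Σℚ a * X + β * s) (Σ-cong (λ j → trans (Σ-cong (λ i → rearrange (a i) (q j) (u j i))) (Σ-*ˡ (q j) (λ i → a i * u j i)))) ⟩
    Σℚ a * X + β * Σℚ (λ j → q j * pairing a j)
      ∎
    where
    open ≡-Reasoning
    distribute : ∀ a x b s → a * (x + b * s) ≡ a * x + b * (a * s)
    distribute = solve-∀ ℚ-ring
    rearrange : ∀ a q u → a * (q * u) ≡ q * (a * u)
    rearrange = solve-∀ ℚ-ring

  mix-≤ : 0ℚ ≤ β → ∀ (a : Fin n → ℚ) (b : ℚ) →
          b * X ≤ Σℚ a * X → (∀ j → q j * b ≤ q j * pairing a j) →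
          b * mix₀ ≤ Σℚ (λ i → a i * mix i)
  mix-≤ 0≤β a b constant-part weighted-parts = begin
    b * (X + β * Σℚ q)                        ≡⟨ distribute b X β (Σℚ q) ⟩
    b * X + β * (Σℚ q * b)                    ≡⟨ cong (λ s → b * X + β * s) (sym (Σ-*ʳ b q)) ⟩
    b * X + β * Σℚ (λ j → q j * b)            ≤⟨ +-mono-≤ constant-part (*-monoˡ-≤-0≤ 0≤β (Σ-mono-≤ weighted-parts)) ⟩
    Σℚ a * X + β * Σℚ (λ j → q j * pairing a j) ≡⟨ mix-expand a ⟨
    Σℚ (λ i → a i * mix i)                    ∎
    where
    open ℚP.≤-Reasoning
    distribute : ∀ b x β s → b * (x + β * s) ≡ b * x + β * (s * b)
    distribute = solve-∀ ℚ-ring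

Σ-init-last : ∀ {k} (g : Fin (ℕ.suc k) → ℚ) → Σℚ g ≡ Σℚ (g ∘ inject₁) + g (fromℕ k)
Σ-init-last {ℕ.zero}  g = trans (ℚP.+-identityʳ (g zero)) (sym (ℚP.+-identityˡ (g zero)))
Σ-init-last {ℕ.suc k} g = trans (cong (_+_ (g zero)) (Σ-init-last (g ∘ suc))) (sym (ℚP.+-assoc (g zero) _ _))

next-inject₁ : ∀ {k} (i : Fin k) → next {k} (inject₁ i) ≡ suc i
next-inject₁ {k} i = FinP.toℕ-injective (begin
  toℕ (next (inject₁ i))               ≡⟨ FinP.toℕ-fromℕ< _ ⟩
  ℕ.suc (toℕ (inject₁ i)) % ℕ.suc k    ≡⟨ cong (λ x → ℕ.suc x % ℕ.suc k) (FinP.toℕ-inject₁ i) ⟩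
  ℕ.suc (toℕ i) % ℕ.suc k              ≡⟨ m<n⇒m%n≡m (ℕ.s≤s (FinP.toℕ<n i)) ⟩
  ℕ.suc (toℕ i)                        ∎)
  where open ≡-Reasoning

next-last : ∀ k → next {k} (fromℕ k) ≡ zero
next-last k = FinP.toℕ-injective (begin
  toℕ (next (fromℕ k))                 ≡⟨ FinP.toℕ-fromℕ< _ ⟩
  ℕ.suc (toℕ (fromℕ k)) % ℕ.suc k      ≡⟨ cong (λ x → ℕ.suc x % ℕ.suc k) (FinP.toℕ-fromℕ k) ⟩
  ℕ.suc k % ℕ.suc k                    ≡⟨ n%n≡0 (ℕ.suc k) ⟩
  0                                    ∎)
  where open ≡-Reasoning

Σ-rotate : ∀ {k} (f : Fin (ℕ.suc k) → ℚ) → Σℚ (f ∘ next) ≡ Σℚ f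
Σ-rotate {k} f = begin
  Σℚ (f ∘ next)                                   ≡⟨ Σ-init-last (f ∘ next) ⟩
  Σℚ (λ i → f (next (inject₁ i))) + f (next (fromℕ k)) ≡⟨ cong₂ _+_ (Σ-cong (cong f ∘ next-inject₁)) (cong f (next-last k)) ⟩
  Σℚ (f ∘ suc) + f zero                           ≡⟨ ℚP.+-comm _ (f zero) ⟩
  Σℚ f                                            ∎
  where open ≡-Reasoning

module _ {G : Digraph} (D : Dicycle G) where

  positions-of : ∀ e → Σℚ (λ i → 𝟙 ⌊ edge D i ≟ e ⌋) ≡ 𝟙 (lookup (edgeSet D) e)
  positions-of e rewrite VecP.lookup∘tabulate (λ e → ⌊ FinP.any? (λ i → edge D i ≟ e) ⌋) e
    with FinP.any? (λ i → edge D i ≟ e)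
  ... | yes (i₀ , i₀↦e) = trans (Σ-cong (λ i → trans (cong 𝟙 (same-test i)) (sym (ℚP.*-identityʳ _)))) (Σ-delta i₀ (λ _ → 1ℚ))
    where
    -- D is simple, so its edges are pairwise distinct
    same-test : ∀ i → ⌊ edge D i ≟ e ⌋ ≡ ⌊ i₀ ≟ i ⌋
    same-test i with edge D i ≟ e | i₀ ≟ i
    ... | yes _   | yes _    = refl
    ... | yes i↦e | no i₀≢i  = ⊥-elim (i₀≢i (simple D (cong (src G) (trans i₀↦e (sym i↦e)))))
    ... | no i↦̸e  | yes refl = ⊥-elim (i↦̸e i₀↦e)
    ... | no _    | no _     = refl
  ... | no e∉D = trans (Σ-cong no-position) (Σ-zero {ℕ.suc (len D)})
    where
    no-position : ∀ i → 𝟙 ⌊ edge D i ≟ e ⌋ ≡ 0ℚ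
    no-position i with edge D i ≟ e
    ... | yes i↦e = ⊥-elim (e∉D (i , i↦e))
    ... | no _    = refl

  Σ-edgeSet : ∀ (g : Fin (m G) → ℚ) → Σℚ (λ e → g e * 𝟙 (lookup (edgeSet D) e)) ≡ Σℚ (λ i → g (edge D i))
  Σ-edgeSet g = begin
    Σℚ (λ e → g e * 𝟙 (lookup (edgeSet D) e))              ≡⟨ Σ-cong (λ e → cong (g e *_) (sym (positions-of e))) ⟩
    Σℚ (λ e → g e * Σℚ (λ i → 𝟙 ⌊ edge D i ≟ e ⌋))         ≡⟨ Σ-cong (λ e → sym (Σ-*ˡ (g e) (λ i → 𝟙 ⌊ edge D i ≟ e ⌋))) ⟩
    Σℚ (λ e → Σℚ (λ i → g e * 𝟙 ⌊ edge D i ≟ e ⌋))         ≡⟨ Σ-comm (λ e i → g e * 𝟙 ⌊ edge D i ≟ e ⌋) ⟩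
    Σℚ (λ i → Σℚ (λ e → g e * 𝟙 ⌊ edge D i ≟ e ⌋))         ≡⟨ Σ-cong (λ i → trans (Σ-cong (λ e → ℚP.*-comm (g e) (𝟙 ⌊ edge D i ≟ e ⌋))) (Σ-delta (edge D i) g)) ⟩
    Σℚ (λ i → g (edge D i))                                ∎
    where open ≡-Reasoning

  Σ-edgeSet-potential : ∀ (h : Fin (n G) → ℚ) (a : Fin (m G) → ℚ) → (∀ e → a e ≡ h (src G e) - h (tgt G e)) →
                        Σℚ (λ e → a e * 𝟙 (lookup (edgeSet D) e)) ≡ 0ℚ
  Σ-edgeSet-potential h a a≡dh = begin
    Σℚ (λ e → a e * 𝟙 (lookup (edgeSet D) e))     ≡⟨ Σ-edgeSet a ⟩
    Σℚ (λ i → a (edge D i))                       ≡⟨ Σ-cong (λ i → a≡dh (edge D i)) ⟩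
    Σℚ (λ i → h (src G (edge D i)) - h (tgt G (edge D i)))
                                                  ≡⟨ Σ-distrib-- (λ i → h (src G (edge D i))) (λ i → h (tgt G (edge D i))) ⟩
    Σsrc - Σℚ (λ i → h (tgt G (edge D i)))        ≡⟨ cong (_-_ Σsrc) tails-are-heads ⟩
    Σsrc - Σsrc                                   ≡⟨ ℚP.+-inverseʳ Σsrc ⟩
    0ℚ                                            ∎
    where
    open ≡-Reasoning
    Σsrc = Σℚ (λ i → h (src G (edge D i)))
    -- the targets of the cycle's edges are its sources, shifted by one
    tails-are-heads : Σℚ (λ i → h (tgt G (edge D i))) ≡ Σsrc
    tails-are-heads = trans (Σ-cong (λ i → cong h (closed D i))) (Σ-rotate (λ i → h (src G (edge D i))))

false≢true : false ≢ true
false≢true ()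

module _ (G : Digraph) {A : Subset (m G)} (X : Subset (n G)) where

  walk-enters : ∀ {u v} → Reach G A u v → lookup X u ≡ false → lookup X v ≡ true →
                ∃ λ e → e Sub.∈ A × inB G X e ≡ true
  walk-enters here               u∉X v∈X = ⊥-elim (false≢true (trans (sym u∉X) v∈X))
  walk-enters (step e e∈A walk) u∉X v∈X with lookup X (tgt G e) in tgt∈?X
  ... | true  = e , e∈A , cong₂ (λ x y → x ∧ not y) tgt∈?X u∉X
  ... | false = walk-enters walk tgt∈?X v∈X

  walk-leaves : ∀ {u v} → Reach G A u v → lookup X u ≡ true → lookup X v ≡ false →
                ∃ λ e → e Sub.∈ A × outB G X e ≡ true
  walk-leaves here               u∈X v∉X = ⊥-elim (false≢true (trans (sym v∉X) u∈X))
  walk-leaves (step e e∈A walk) u∈X v∉X with lookup X (tgt G e) in tgt∈?X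
  ... | false = e , e∈A , cong₂ (λ x y → x ∧ not y) u∈X tgt∈?X
  ... | true  = walk-leaves walk tgt∈?X v∉X

module Partition {G : Digraph} {N : ℕ} {C : Fin N → Dicycle G} {F : Subset N}
                 (GD : GoodDecomposition G N C F) where
  open GoodDecomposition GD

  cycles-through : ∀ e → Σℚ (λ j → 𝟙 (lookup (edgeSet (C j)) e)) ≡ 1ℚ
  cycles-through e with cover e
  ... | j₀ , e∈C[j₀] = trans (Σ-cong (λ j → trans (cong 𝟙 (only-j₀ j)) (sym (ℚP.*-identityʳ _)))) (Σ-delta j₀ (λ _ → 1ℚ))
    where
    only-j₀ : ∀ j → lookup (edgeSet (C j)) e ≡ ⌊ j₀ ≟ j ⌋
    only-j₀ j with j₀ ≟ j
    ... | yes refl = VecP.[]=⇒lookup e∈C[j₀]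
    ... | no j₀≢j with lookup (edgeSet (C j)) e in e∈?C[j]
    ...   | true  = ⊥-elim (j₀≢j (disjoint e j₀ j e∈C[j₀] (VecP.lookup⇒[]= e _ e∈?C[j])))
    ...   | false = refl

  Σ-partition : ∀ (g : Fin (m G) → ℚ) → Σℚ (λ j → Σℚ (λ e → g e * 𝟙 (lookup (edgeSet (C j)) e))) ≡ Σℚ g
  Σ-partition g = begin
    Σℚ (λ j → Σℚ (λ e → g e * 𝟙 (lookup (edgeSet (C j)) e)))   ≡⟨ Σ-comm (λ j e → g e * 𝟙 (lookup (edgeSet (C j)) e)) ⟩
    Σℚ (λ e → Σℚ (λ j → g e * 𝟙 (lookup (edgeSet (C j)) e)))   ≡⟨ Σ-cong (λ e → trans (Σ-*ˡ (g e) (λ j → 𝟙 (lookup (edgeSet (C j)) e))) (cong (g e *_) (cycles-through e))) ⟩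
    Σℚ (λ e → g e * 1ℚ)                                        ≡⟨ Σ-cong (λ e → ℚP.*-identityʳ (g e)) ⟩
    Σℚ g                                                       ∎
    where open ≡-Reasoning

module VectorY {G : Digraph} {N : ℕ} (C : Fin N → Dicycle G) (F Q : Subset N) (t : ℕ) where

  E : Fin N → Subset (m G)
  E j = edgeSet (C j)

  counted : Fin N → Bool
  counted j = lookup F j ∧ not (lookup Q j)

  counted⇒∈F : ∀ j → counted j ≡ true → j Sub.∈ F
  counted⇒∈F j counted-j with lookup F j in j∈?F
  ... | true = VecP.lookup⇒[]= j F j∈?F

  β : ℚ
  β = + 1 / ℕ.suc (ℕ.suc t)

  0≤β : 0ℚ ≤ β
  0≤β = 0≤k/n 1 (ℕ.suc t)

  counted# : ℚ
  counted# = Σℚ (λ j → 𝟙 (counted j))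

  missing# : Subset (m G) → ℚ
  missing# U = Σℚ (λ j → 𝟙 (counted j) * 𝟙 (isEmpty (E j ∩ U)))

  α : ℚ
  α = 1ℚ - β * counted#

  y : Subset (m G) → ℚ
  y = yQt C F Q t

  g-as-Σ : ∀ U → natℚ (gQ C F Q U) ≡ Σℚ (λ j → 𝟙 (counted j) * (1ℚ - 𝟙 (isEmpty (E j ∩ U))))
  g-as-Σ U = begin
    natℚ (gQ C F Q U)                                            ≡⟨ ∣∣-as-Σ (tabulate meets) ⟩
    Σℚ (λ j → 𝟙 (lookup (tabulate meets) j))                     ≡⟨ Σ-cong (λ j → cong 𝟙 (VecP.lookup∘tabulate meets j)) ⟩
    Σℚ (λ j → 𝟙 (meets j))                                       ≡⟨ Σ-cong meets-as-product ⟩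
    Σℚ (λ j → 𝟙 (counted j) * (1ℚ - 𝟙 (isEmpty (E j ∩ U))))     ∎
    where
    open ≡-Reasoning
    meets : Fin N → Bool
    meets j = lookup F j ∧ not (lookup Q j) ∧ ⌊ SubP.nonempty? (E j ∩ U) ⌋
    meets-as-product : ∀ j → 𝟙 (meets j) ≡ 𝟙 (counted j) * (1ℚ - 𝟙 (isEmpty (E j ∩ U)))
    meets-as-product j = begin
      𝟙 (meets j)                                           ≡⟨ cong 𝟙 (sym (BoolP.∧-assoc (lookup F j) _ _)) ⟩
      𝟙 (counted j ∧ ⌊ SubP.nonempty? (E j ∩ U) ⌋)          ≡⟨ cong (λ b → 𝟙 (counted j ∧ b)) (nonempty?≡not-isEmpty (E j ∩ U)) ⟩
      𝟙 (counted j ∧ not (isEmpty (E j ∩ U)))               ≡⟨ 𝟙-∧ (counted j) _ ⟩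
      𝟙 (counted j) * 𝟙 (not (isEmpty (E j ∩ U)))           ≡⟨ cong (𝟙 (counted j) *_) (𝟙-not (isEmpty (E j ∩ U))) ⟩
      𝟙 (counted j) * (1ℚ - 𝟙 (isEmpty (E j ∩ U)))          ∎

  g-as-difference : ∀ U → natℚ (gQ C F Q U) ≡ counted# - missing# U
  g-as-difference U = begin
    natℚ (gQ C F Q U)                                                ≡⟨ g-as-Σ U ⟩
    Σℚ (λ j → 𝟙 (counted j) * (1ℚ - 𝟙 (isEmpty (E j ∩ U))))         ≡⟨ Σ-cong (λ j → distribute (𝟙 (counted j)) _) ⟩
    Σℚ (λ j → 𝟙 (counted j) - 𝟙 (counted j) * 𝟙 (isEmpty (E j ∩ U))) ≡⟨ Σ-distrib-- (λ j → 𝟙 (counted j)) (λ j → 𝟙 (counted j) * 𝟙 (isEmpty (E j ∩ U))) ⟩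
    counted# - missing# U                                            ∎
    where
    open ≡-Reasoning
    distribute : ∀ c w → c * (1ℚ - w) ≡ c - c * w
    distribute = solve-∀ ℚ-ring

  y-form : ∀ U → y U ≡ 1ℚ - β * natℚ (gQ C F Q U)
  y-form U = complement-fraction (ℕ.suc t) (gQ C F Q U)

  y-affine : ∀ U → y U ≡ α + β * missing# U
  y-affine U = begin
    y U                                    ≡⟨ y-form U ⟩
    1ℚ - β * natℚ (gQ C F Q U)             ≡⟨ cong (λ g → 1ℚ - β * g) (g-as-difference U) ⟩
    1ℚ - β * (counted# - missing# U)       ≡⟨ regroup β counted# (missing# U) ⟩
    α + β * missing# U                     ∎
    where
    open ≡-Reasoning
    regroup : ∀ b k w → 1ℚ - b * (k - w) ≡ (1ℚ - b * k) + b * w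
    regroup = solve-∀ ℚ-ring

  -- since β (t + 2) = 1:  1 - β k = β r  whenever r + k = t + 2
  1-βk : ∀ k r → r ℕ.+ k ≡ ℕ.suc (ℕ.suc t) → 1ℚ - β * natℚ k ≡ β * natℚ r
  1-βk k r r+k≡t+2 = begin
    1ℚ - β * natℚ k                           ≡⟨ cong (λ x → x - β * natℚ k) (sym (1/n*n≡1 (ℕ.suc t))) ⟩
    β * natℚ (ℕ.suc (ℕ.suc t)) - β * natℚ k   ≡⟨ cong (λ x → β * natℚ x - β * natℚ k) (sym r+k≡t+2) ⟩
    β * natℚ (r ℕ.+ k) - β * natℚ k           ≡⟨ cong (λ x → β * x - β * natℚ k) (natℚ-+ r k) ⟩
    β * (natℚ r + natℚ k) - β * natℚ k        ≡⟨ cancel β (natℚ r) (natℚ k) ⟩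
    β * natℚ r                                ∎
    where
    open ≡-Reasoning
    cancel : ∀ b r k → b * (r + k) - b * k ≡ b * r
    cancel = solve-∀ ℚ-ring

  -- with the edges partitioned into cycles, g_Q(U) ≤ |U| and hence y U ≥ 1 - β|U|
  module Bounds (GD : GoodDecomposition G N C F) where
    open Partition GD

    g≤∣U∣ : ∀ U → natℚ (gQ C F Q U) ≤ natℚ ∣ U ∣
    g≤∣U∣ U = begin
      natℚ (gQ C F Q U)                                           ≡⟨ g-as-Σ U ⟩
      Σℚ (λ j → 𝟙 (counted j) * (1ℚ - 𝟙 (isEmpty (E j ∩ U))))    ≤⟨ Σ-mono-≤ (λ j → *-≤-[0,1] (0≤𝟙 (counted j)) (𝟙≤1 (counted j)) (≤⇒0≤-sub (𝟙≤1 (isEmpty (E j ∩ U))))) ⟩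
      Σℚ (λ j → 1ℚ - 𝟙 (isEmpty (E j ∩ U)))                       ≤⟨ Σ-mono-≤ (λ j → 1-𝟙isEmpty≤Σ (E j ∩ U)) ⟩
      Σℚ (λ j → Σℚ (λ e → 𝟙 (lookup (E j ∩ U) e)))                ≡⟨ Σ-cong (λ j → Σ-cong (λ e → in-both j e)) ⟩
      Σℚ (λ j → Σℚ (λ e → 𝟙 (lookup U e) * 𝟙 (lookup (E j) e)))   ≡⟨ Σ-partition (λ e → 𝟙 (lookup U e)) ⟩
      Σℚ (λ e → 𝟙 (lookup U e))                                   ≡⟨ ∣∣-as-Σ U ⟨
      natℚ ∣ U ∣                                                  ∎
      where
      open ℚP.≤-Reasoning
      in-both : ∀ j e → 𝟙 (lookup (E j ∩ U) e) ≡ 𝟙 (lookup U e) * 𝟙 (lookup (E j) e)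
      in-both j e = trans (cong 𝟙 (VecP.lookup-zipWith _∧_ e (E j) U))
                          (trans (𝟙-∧ (lookup (E j) e) (lookup U e)) (ℚP.*-comm (𝟙 (lookup (E j) e)) _))

    y-lower : ∀ U k → ∣ U ∣ ℕ.≤ k → 1ℚ - β * natℚ k ≤ y U
    y-lower U k ∣U∣≤k = begin
      1ℚ - β * natℚ k                ≤⟨ +-monoʳ-≤ 1ℚ (neg-antimono-≤ (*-monoˡ-≤-0≤ 0≤β (≤-trans (g≤∣U∣ U) (natℚ-mono ∣U∣≤k)))) ⟩
      1ℚ - β * natℚ (gQ C F Q U)     ≡⟨ y-form U ⟨
      y U                            ∎
      where open ℚP.≤-Reasoning

    y≥β : ∀ U → ∣ U ∣ ℕ.≤ ℕ.suc t → β ≤ y U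
    y≥β U ∣U∣≤t+1 = ≤-trans (≤-reflexive (trans (sym (ℚP.*-identityʳ β)) (sym (1-βk (ℕ.suc t) 1 refl)))) (y-lower U (ℕ.suc t) ∣U∣≤t+1)

    y≥2β : ∀ U → ∣ U ∣ ℕ.≤ t → β + β ≤ y U
    y≥2β U ∣U∣≤t = ≤-trans (≤-reflexive (trans (double β) (sym (1-βk t 2 refl)))) (y-lower U t ∣U∣≤t)
      where
      double : ∀ b → b + b ≡ b * (1ℚ + 1ℚ)
      double = solve-∀ ℚ-ring

  altSum-y : ∀ Q' A → altSum Q' (λ T → y (A ∪ T))
                      ≡ 𝟙 (isEmpty Q') * α + β * Σℚ (λ j → 𝟙 (counted j) * 𝟙 (missesAndContains (E j) A Q'))
  altSum-y Q' A = begin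
    altSum Q' (λ T → y (A ∪ T))                                      ≡⟨ altSum-cong Q' (λ T → y-affine (A ∪ T)) ⟩
    altSum Q' (λ T → α + β * missing# (A ∪ T))                       ≡⟨ altSum-+ Q' (λ _ → α) (λ T → β * missing# (A ∪ T)) ⟩
    altSum Q' (λ _ → α) + altSum Q' (λ T → β * missing# (A ∪ T))     ≡⟨ cong₂ _+_ (altSum-const Q' α) (altSum-*ˡ Q' β (λ T → missing# (A ∪ T))) ⟩
    𝟙 (isEmpty Q') * α + β * altSum Q' (λ T → missing# (A ∪ T))      ≡⟨ cong (λ s → 𝟙 (isEmpty Q') * α + β * s) altSum-missing ⟩
    𝟙 (isEmpty Q') * α + β * Σℚ (λ j → 𝟙 (counted j) * 𝟙 (missesAndContains (E j) A Q')) ∎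
    where
    open ≡-Reasoning
    altSum-missing : altSum Q' (λ T → missing# (A ∪ T)) ≡ Σℚ (λ j → 𝟙 (counted j) * 𝟙 (missesAndContains (E j) A Q'))
    altSum-missing = trans (altSum-Σ Q' (λ j T → 𝟙 (counted j) * 𝟙 (isEmpty (E j ∩ (A ∪ T)))))
      (Σ-cong (λ j → trans (altSum-*ˡ Q' (𝟙 (counted j)) (λ T → 𝟙 (isEmpty (E j ∩ (A ∪ T)))))
                           (cong (𝟙 (counted j) *_) (altSum-disjoint (E j) A Q'))))

  -- The lifted quantities of a Sherali–Adams inequality at (S, Q'), in mixture form:
  -- weight j is 1 exactly for the counted cycles missing S and containing Q',
  -- and adding the edge i to S keeps the weight iff i lies outside the cycle.
  module Lifted (Q' S : Subset (m G)) where

    weight : Fin N → ℚ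
    weight j = 𝟙 (counted j) * 𝟙 (missesAndContains (E j) S Q')

    outside : Fin N → Fin (m G) → ℚ
    outside j i = 𝟙 (not (lookup (E j) i))

    open Mixture (𝟙 (isEmpty Q') * α) β weight outside public

    lifted₀ : altSum Q' (λ T → y (S ∪ T)) ≡ mix₀
    lifted₀ = altSum-y Q' S

    lifted : ∀ i → altSum Q' (λ T → y (S ∪ T ∪ ⁅ i ⁆)) ≡ mix i
    lifted i = begin
      altSum Q' (λ T → y (S ∪ T ∪ ⁅ i ⁆))     ≡⟨ altSum-cong Q' (λ T → cong y (reorder T)) ⟩
      altSum Q' (λ T → y ((S ∪ ⁅ i ⁆) ∪ T))   ≡⟨ altSum-y Q' (S ∪ ⁅ i ⁆) ⟩
      𝟙 (isEmpty Q') * α + β * Σℚ (λ j → 𝟙 (counted j) * 𝟙 (missesAndContains (E j) (S ∪ ⁅ i ⁆) Q'))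
                                              ≡⟨ cong (λ s → 𝟙 (isEmpty Q') * α + β * s) (Σ-cong split-weight) ⟩
      mix i                                   ∎
      where
      open ≡-Reasoning
      reorder : ∀ T → S ∪ T ∪ ⁅ i ⁆ ≡ (S ∪ ⁅ i ⁆) ∪ T
      reorder T = trans (cong (S ∪_) (SubP.∪-comm T ⁅ i ⁆)) (sym (SubP.∪-assoc S ⁅ i ⁆ T))
      split-weight : ∀ j → 𝟙 (counted j) * 𝟙 (missesAndContains (E j) (S ∪ ⁅ i ⁆) Q') ≡ weight j * outside j i
      split-weight j = trans (cong (λ b → 𝟙 (counted j) * 𝟙 b) (missesAndContains-∪⁅⁆ (E j) S Q' i))
                             (trans (cong (𝟙 (counted j) *_) (𝟙-∧ (missesAndContains (E j) S Q') _))
                                    (sym (ℚP.*-assoc (𝟙 (counted j)) _ _)))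

    mix₀≡y : isEmpty Q' ≡ true → mix₀ ≡ y S
    mix₀≡y empty = begin
      mix₀                           ≡⟨ lifted₀ ⟨
      altSum Q' (λ T → y (S ∪ T))    ≡⟨ altSum-empty Q' empty (λ T → y (S ∪ T)) ⟩
      y (S ∪ Sub.⊥)                  ≡⟨ cong y (SubP.∪-identityʳ S) ⟩
      y S                            ∎
      where open ≡-Reasoning

    mix≡y : isEmpty Q' ≡ true → ∀ i → mix i ≡ y (S ∪ ⁅ i ⁆)
    mix≡y empty i = begin
      mix i                                    ≡⟨ lifted i ⟨
      altSum Q' (λ T → y (S ∪ T ∪ ⁅ i ⁆))      ≡⟨ altSum-empty Q' empty (λ T → y (S ∪ T ∪ ⁅ i ⁆)) ⟩
      y (S ∪ Sub.⊥ ∪ ⁅ i ⁆)                    ≡⟨ cong (λ U → y (S ∪ U)) (SubP.∪-identityˡ ⁅ i ⁆) ⟩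
      y (S ∪ ⁅ i ⁆)                            ∎
      where open ≡-Reasoning

    weight-cases : ∀ j → counted j ≡ true ⊎ weight j ≡ 0ℚ
    weight-cases j with true-or-false (counted j)
    ... | inj₁ counted-j   = inj₁ counted-j
    ... | inj₂ uncounted-j = inj₂ (trans (cong (λ b → 𝟙 b * 𝟙 (missesAndContains (E j) S Q')) uncounted-j)
                                         (ℚP.*-zeroˡ (𝟙 (missesAndContains (E j) S Q'))))

    weightless : ∀ j x → weight j ≡ 0ℚ → weight j * x ≡ 0ℚ
    weightless j x w≡0 = trans (cong (_* x) w≡0) (ℚP.*-zeroˡ x)

    0≤weight : ∀ j → 0ℚ ≤ weight j
    0≤weight j = 0≤-* (0≤𝟙 (counted j)) (0≤𝟙 (missesAndContains (E j) S Q'))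

    weight≤1 : ∀ j → weight j ≤ 1ℚ
    weight≤1 j = ≤-trans (*-≤-[0,1] (0≤𝟙 (counted j)) (𝟙≤1 (counted j)) (0≤𝟙 b)) (𝟙≤1 b)
      where b = missesAndContains (E j) S Q'

    pairing-complement : ∀ a j → pairing a j ≡ Σℚ a - Σℚ (λ i → a i * 𝟙 (lookup (E j) i))
    pairing-complement a j = begin
      Σℚ (λ i → a i * 𝟙 (not (lookup (E j) i)))               ≡⟨ Σ-cong (λ i → trans (cong (a i *_) (𝟙-not (lookup (E j) i))) (distribute (a i) _)) ⟩
      Σℚ (λ i → a i - a i * 𝟙 (lookup (E j) i))               ≡⟨ Σ-distrib-- a (λ i → a i * 𝟙 (lookup (E j) i)) ⟩
      Σℚ a - Σℚ (λ i → a i * 𝟙 (lookup (E j) i))              ∎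
      where
      open ≡-Reasoning
      distribute : ∀ a c → a * (1ℚ - c) ≡ a - a * c
      distribute = solve-∀ ℚ-ring

    -- for nonempty Q' the constant part vanishes, so only counted cycles matter
    nonempty-≤ : isEmpty Q' ≡ false → ∀ a b → (∀ j → counted j ≡ true → b ≤ pairing a j) →
                 b * mix₀ ≤ Σℚ (λ i → a i * mix i)
    nonempty-≤ nonempty a b counted⇒≤ = mix-≤ 0≤β a b constant-part weighted-part
      where
      X≡0 : 𝟙 (isEmpty Q') * α ≡ 0ℚ
      X≡0 rewrite nonempty = ℚP.*-zeroˡ α
      constant-part : b * (𝟙 (isEmpty Q') * α) ≤ Σℚ a * (𝟙 (isEmpty Q') * α)
      constant-part rewrite X≡0 = ≤-reflexive (trans (ℚP.*-zeroʳ b) (sym (ℚP.*-zeroʳ (Σℚ a))))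
      weighted-part : ∀ j → weight j * b ≤ weight j * pairing a j
      weighted-part j with weight-cases j
      ... | inj₁ counted-j = *-monoˡ-≤-0≤ (0≤weight j) (counted⇒≤ j counted-j)
      ... | inj₂ w≡0       = ≤-reflexive (trans (weightless j b w≡0) (sym (weightless j (pairing a j) w≡0)))

  -- the inequality a·x ≥ b of the system, lifted at (S, Q') and evaluated on y
  LiftedHolds : (Fin (m G) → ℚ) → ℚ → Subset (m G) → Subset (m G) → Set
  LiftedHolds a b Q' S = let open Lifted Q' S in b * mix₀ ≤ Σℚ (λ i → a i * mix i)

∈∁⇒lookup≡false : ∀ {k} {x : Fin k} {p : Subset k} → x Sub.∈ ∁ p → lookup p x ≡ false
∈∁⇒lookup≡false {x = x} {p} x∈∁p =
  trans (sym (BoolP.not-involutive (lookup p x))) (cong not (trans (sym (VecP.lookup-map x not p)) (VecP.[]=⇒lookup x∈∁p)))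

module Constraints (G : Digraph) (SC : StronglyConnected G) {N : ℕ} (C : Fin N → Dicycle G) (F Q : Subset N)
                   (GD : GoodDecomposition G N C F) (t : ℕ) where
  open VectorY C F Q t
  open Bounds GD
  open Partition GD
  open GoodDecomposition GD using (F-good)

  -- equality constraints: coefficients given by potential differences vanish on
  -- every cycle, hence in total and on the complement of every cycle
  potential-lifts : ∀ (h : Fin (n G) → ℚ) (a : Fin (m G) → ℚ) → (∀ e → a e ≡ h (src G e) - h (tgt G e)) →
                    ∀ Q' S → LiftedHolds a 0ℚ Q' S
  potential-lifts h a a≡dh Q' S = mix-≤ 0≤β a 0ℚ constant-part weighted-part
    where
    open Lifted Q' S
    on-cycle : ∀ j → Σℚ (λ e → a e * 𝟙 (lookup (E j) e)) ≡ 0ℚ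
    on-cycle j = Σ-edgeSet-potential (C j) h a a≡dh
    total : Σℚ a ≡ 0ℚ
    total = trans (sym (Σ-partition a)) (trans (Σ-cong on-cycle) (Σ-zero {N}))
    constant-part : 0ℚ * (𝟙 (isEmpty Q') * α) ≤ Σℚ a * (𝟙 (isEmpty Q') * α)
    constant-part = ≤-reflexive (cong (_* (𝟙 (isEmpty Q') * α)) (sym total))
    weighted-part : ∀ j → weight j * 0ℚ ≤ weight j * pairing a j
    weighted-part j = ≤-reflexive (cong (weight j *_) (sym (trans (pairing-complement a j) (cong₂ _-_ total (on-cycle j)))))

  lower-lifts : ∀ f Q' S → ∣ S ∣ ℕ.≤ t → LiftedHolds (λ e → 𝟙 ⌊ f ≟ e ⌋) 0ℚ Q' S
  lower-lifts f Q' S ∣S∣≤t with true-or-false (isEmpty Q')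
  ... | inj₂ nonempty = nonempty-≤ nonempty a 0ℚ (λ j _ → Σ-nonNeg (λ i → 0≤-* (0≤𝟙 ⌊ f ≟ i ⌋) (0≤𝟙 (not (lookup (E j) i)))))
    where
    open Lifted Q' S
    a = λ e → 𝟙 ⌊ f ≟ e ⌋
  ... | inj₁ empty = begin
    0ℚ * mix₀                            ≡⟨ ℚP.*-zeroˡ mix₀ ⟩
    0ℚ                                   ≤⟨ 0≤β ⟩
    β                                    ≤⟨ y≥β (S ∪ ⁅ f ⁆) (ℕP.≤-trans (∣∪⁅⁆∣≤ S f) (ℕ.s≤s ∣S∣≤t)) ⟩
    y (S ∪ ⁅ f ⁆)                        ≡⟨ mix≡y empty f ⟨
    mix f                                ≡⟨ Σ-delta f mix ⟨
    Σℚ (λ i → 𝟙 ⌊ f ≟ i ⌋ * mix i)       ∎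
    where
    open Lifted Q' S
    open ℚP.≤-Reasoning

  upper-lifts : ∀ f Q' S → LiftedHolds (λ e → - 𝟙 ⌊ f ≟ e ⌋) (- 1ℚ) Q' S
  upper-lifts f Q' S = mix-≤ 0≤β a (- 1ℚ) constant-part weighted-part
    where
    open Lifted Q' S
    a : Fin (m G) → ℚ
    a e = - 𝟙 ⌊ f ≟ e ⌋
    total : Σℚ a ≡ - 1ℚ
    total = trans (Σ-neg (λ e → 𝟙 ⌊ f ≟ e ⌋))
                  (cong -_ (trans (Σ-cong (λ e → sym (ℚP.*-identityʳ (𝟙 ⌊ f ≟ e ⌋)))) (Σ-delta f (λ _ → 1ℚ))))
    constant-part : - 1ℚ * (𝟙 (isEmpty Q') * α) ≤ Σℚ a * (𝟙 (isEmpty Q') * α)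
    constant-part = ≤-reflexive (cong (_* (𝟙 (isEmpty Q') * α)) (sym total))
    pairing≡ : ∀ j → pairing a j ≡ - 𝟙 (not (lookup (E j) f))
    pairing≡ j = trans (Σ-cong (λ i → sym (ℚP.neg-distribˡ-* (𝟙 ⌊ f ≟ i ⌋) (outside j i))))
                       (trans (Σ-neg (λ i → 𝟙 ⌊ f ≟ i ⌋ * outside j i)) (cong -_ (Σ-delta f (outside j))))
    weighted-part : ∀ j → weight j * - 1ℚ ≤ weight j * pairing a j
    weighted-part j = *-monoˡ-≤-0≤ (0≤weight j) (≤-trans (neg-antimono-≤ (𝟙≤1 (not (lookup (E j) f)))) (≤-reflexive (sym (pairing≡ j))))

  -- cut constraints x(δ(X)) ≥ 1, for the indicator h of a cut δ(X) which G crosses,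
  -- and which G − E(C_j) still crosses for every counted cycle C_j
  module Cut (h : Fin (m G) → Bool) (crossed : ∃ λ e → h e ≡ true)
             (crossed-off : ∀ j → counted j ≡ true → ∃ λ e → h e ≡ true × lookup (E j) e ≡ false) where

    a : Fin (m G) → ℚ
    a e = 𝟙 (h e)

    d : ℚ
    d = Σℚ a

    shared : Fin N → ℚ
    shared j = Σℚ (λ i → a i * 𝟙 (lookup (E j) i))

    1≤d : 1ℚ ≤ d
    1≤d = ≤-trans (≤-reflexive (cong 𝟙 (sym (proj₂ crossed)))) (term≤Σ (λ i → 0≤𝟙 (h i)) (proj₁ crossed))

    module _ (Q' S : Subset (m G)) where
      open Lifted Q' S

      1≤pairing : ∀ j → counted j ≡ true → 1ℚ ≤ pairing a j
      1≤pairing j counted-j with crossed-off j counted-j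
      ... | e , h-e , e∉C = ≤-trans (≤-reflexive (cong₂ (λ x y → 𝟙 x * 𝟙 (not y)) (sym h-e) (sym e∉C)))
                                    (term≤Σ (λ i → 0≤-* (0≤𝟙 (h i)) (0≤𝟙 (not (lookup (E j) i)))) e)

      K : ℚ
      K = Σℚ (λ j → weight j * shared j)

      K≤d : K ≤ d
      K≤d = ≤-trans (Σ-mono-≤ (λ j → *-≤-[0,1] (0≤weight j) (weight≤1 j) (0≤shared j))) (≤-reflexive (Σ-partition a))
        where
        0≤shared : ∀ j → 0ℚ ≤ shared j
        0≤shared j = Σ-nonNeg (λ i → 0≤-* (0≤𝟙 (h i)) (0≤𝟙 (lookup (E j) i)))

      -- a counted cycle meeting the cut forces a second cut edge outside it
      small-d⇒K≡0 : ¬ (1ℚ + 1ℚ ≤ d) → K ≡ 0ℚ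
      small-d⇒K≡0 ¬2≤d = trans (Σ-cong vanishes) (Σ-zero {N})
        where
        vanishes : ∀ j → weight j * shared j ≡ 0ℚ
        vanishes j with weight-cases j | Σ𝟙-0-or-≥1 (λ i → h i ∧ lookup (E j) i)
        ... | inj₂ w≡0       | _         = weightless j (shared j) w≡0
        ... | inj₁ _         | inj₁ none = trans (cong (weight j *_) (trans (Σ-cong (λ i → sym (𝟙-∧ (h i) _))) none)) (ℚP.*-zeroʳ (weight j))
        ... | inj₁ counted-j | inj₂ some = ⊥-elim (¬2≤d (begin
          1ℚ + 1ℚ                     ≤⟨ +-mono-≤ (1≤pairing j counted-j) (≤-trans some (≤-reflexive (Σ-cong (λ i → 𝟙-∧ (h i) _)))) ⟩
          pairing a j + shared j      ≡⟨ cong (_+ shared j) (pairing-complement a j) ⟩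
          (d - shared j) + shared j   ≡⟨ cancel d (shared j) ⟩
          d                           ∎))
          where
          open ℚP.≤-Reasoning
          cancel : ∀ d x → (d - x) + x ≡ d
          cancel = solve-∀ ℚ-ring

      Σ-a-mix : Σℚ (λ i → a i * mix i) ≡ d * mix₀ - β * K
      Σ-a-mix = begin
        Σℚ (λ i → a i * mix i)                                   ≡⟨ mix-expand a ⟩
        d * X + β * Σℚ (λ j → weight j * pairing a j)            ≡⟨ cong (λ s → d * X + β * s) (Σ-cong (λ j → cong (weight j *_) (pairing-complement a j))) ⟩
        d * X + β * Σℚ (λ j → weight j * (d - shared j))        ≡⟨ cong (λ s → d * X + β * s) (Σ-cong (λ j → distribute (weight j) d (shared j))) ⟩
        d * X + β * Σℚ (λ j → weight j * d - weight j * shared j)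
                                                                 ≡⟨ cong (λ s → d * X + β * s) (Σ-distrib-- (λ j → weight j * d) (λ j → weight j * shared j)) ⟩
        d * X + β * (Σℚ (λ j → weight j * d) - K)                ≡⟨ cong (λ s → d * X + β * (s - K)) (Σ-*ʳ d weight) ⟩
        d * X + β * (Σℚ weight * d - K)                          ≡⟨ regroup d X β (Σℚ weight) K ⟩
        d * mix₀ - β * K                                         ∎
        where
        open ≡-Reasoning
        X = 𝟙 (isEmpty Q') * α
        distribute : ∀ w d x → w * (d - x) ≡ w * d - w * x
        distribute = solve-∀ ℚ-ring
        regroup : ∀ d X b W K → d * X + b * (W * d - K) ≡ d * (X + b * W) - b * K
        regroup = solve-∀ ℚ-ring

    cut-lifts : ∀ Q' S → ∣ S ∣ ℕ.≤ t → LiftedHolds a 1ℚ Q' S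
    cut-lifts Q' S ∣S∣≤t with true-or-false (isEmpty Q')
    ... | inj₂ nonempty = nonempty-≤ nonempty a 1ℚ (1≤pairing Q' S)
      where open Lifted Q' S using (nonempty-≤)
    ... | inj₁ empty = begin
      1ℚ * mix₀                ≡⟨ ℚP.*-identityˡ mix₀ ⟩
      mix₀                     ≤⟨ cut-arithmetic 0≤β 1≤d (≤-trans (y≥2β S ∣S∣≤t) (≤-reflexive (sym (mix₀≡y empty)))) (K≤d Q' S) (small-d⇒K≡0 Q' S) ⟩
      d * mix₀ - β * K Q' S    ≡⟨ Σ-a-mix Q' S ⟨
      Σℚ (λ i → a i * mix i)   ∎
      where
      open Lifted Q' S
      open ℚP.≤-Reasoning

  -- A cut which every walk from u to v must cross is crossed by G and, for every
  -- counted cycle C_j, by G − E(C_j): both are strongly connected.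
  crossed-cut-lifts : ∀ (h : Fin (m G) → Bool) u v → (∀ {A} → Reach G A u v → ∃ λ e → e Sub.∈ A × h e ≡ true) →
                      ∀ Q' S → ∣ S ∣ ℕ.≤ t → LiftedHolds (λ e → 𝟙 (h e)) 1ℚ Q' S
  crossed-cut-lifts h u v cross = Cut.cut-lifts h crossed crossed-off
    where
    crossed : ∃ λ e → h e ≡ true
    crossed with cross (SC u v)
    ... | e , _ , h-e = e , h-e
    crossed-off : ∀ j → counted j ≡ true → ∃ λ e → h e ≡ true × lookup (E j) e ≡ false
    crossed-off j counted-j with cross (F-good j (counted⇒∈F j counted-j) u v)
    ... | e , e∉E[j] , h-e = e , h-e , ∈∁⇒lookup≡false e∉E[j]

  every-constraint-lifts : ∀ c Q' S → ∣ S ∣ ℕ.≤ t → LiftedHolds (balCoef G c) (balRhs G c) Q' S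
  every-constraint-lifts (cutIn X (x , x∈X) (y , y∈∁X)) =
    crossed-cut-lifts (inB G X) y x (λ walk → walk-enters G X walk (∈∁⇒lookup≡false y∈∁X) (VecP.[]=⇒lookup x∈X))
  every-constraint-lifts (cutOut X (x , x∈X) (y , y∈∁X)) =
    crossed-cut-lifts (outB G X) x y (λ walk → walk-leaves G X walk (VecP.[]=⇒lookup x∈X) (∈∁⇒lookup≡false y∈∁X))
  every-constraint-lifts (balOI v) Q' S _ =
    potential-lifts (λ w → 𝟙 (at w)) (balCoef G (balOI v)) (λ e → 𝟙-difference (at (src G e)) (at (tgt G e))) Q' S
    where at = lookup ⁅ v ⁆
  every-constraint-lifts (balIO v) Q' S _ =
    potential-lifts (λ w → - 𝟙 (at w)) (balCoef G (balIO v)) flow Q' S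
    where
    at = lookup ⁅ v ⁆
    negate : ∀ p q → p - q ≡ (- q) - (- p)
    negate = solve-∀ ℚ-ring
    flow : ∀ e → balCoef G (balIO v) e ≡ - 𝟙 (at (src G e)) - - 𝟙 (at (tgt G e))
    flow e = trans (𝟙-difference (at (tgt G e)) (at (src G e))) (negate (𝟙 (at (tgt G e))) (𝟙 (at (src G e))))
  every-constraint-lifts (lower f) Q' S ∣S∣≤t = lower-lifts f Q' S ∣S∣≤t
  every-constraint-lifts (upper f) Q' S _     = upper-lifts f Q' S

-- Evaluate both alternating sums as mixtures and apply every-constraint-lifts.
theorem1 : (G : Digraph) → StronglyConnected G →
    (N : ℕ) (C : Fin N → Dicycle G) (F : Subset N) → GoodDecomposition G N C F →
    (t : ℕ) (Q : Subset N) → Q ⊆ F →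
    InSA (BalancedSystem G) t (yQt C F Q t)
theorem1 G SC N C F GD t Q _ c S Q' _ ∣S∣+∣Q'∣≤t = begin
  balRhs G c * altSum Q' (λ T → y (S ∪ T))                          ≡⟨ cong (balRhs G c *_) lifted₀ ⟩
  balRhs G c * mix₀                                                 ≤⟨ every-constraint-lifts c Q' S (ℕP.m+n≤o⇒m≤o ∣ S ∣ ∣S∣+∣Q'∣≤t) ⟩
  Σℚ (λ i → balCoef G c i * mix i)                                  ≡⟨ Σ-cong (λ i → cong (balCoef G c i *_) (lifted i)) ⟨
  Σℚ (λ i → balCoef G c i * altSum Q' (λ T → y (S ∪ T ∪ ⁅ i ⁆)))   ∎
  where
  open Constraints G SC C F Q GD t using (every-constraint-lifts)
  open VectorY C F Q t using (y; module Lifted)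
  open Lifted Q' S
  open ℚP.≤-Reasoning
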